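{- Let $n\geq3$. The number of permutations $\pi\in\mathfrak{S}_n$ that avoid $123$ as a consecutive pattern and satisfy $\operatorname{ides}(\pi)=1$ is $4$ if $n$ is odd and $5$ if $n$ is even.
   Context: $\mathfrak{S}_n$ is the set of permutations of $[n]$ in one-line notation $\pi=\pi_1\cdots\pi_n$. $\pi$ avoids $123$ as a consecutive pattern if there is no $i\in[n-2]$ with $\pi_i<\pi_{i+1}<\pi_{i+2}$. $\operatorname{des}(\pi)$ is the number of $i\in[n-1]$ with $\pi_i>\pi_{i+1}$, and $\operatorname{ides}(\pi)=\operatorname{des}(\pi^{ -1})$. -}

module Defs where

open import Data.Nat using (ℕ; zero; suc; _+_; _<_; _<ᵇ_)
open import Data.Bool using (Bool; true; false; if_then_else_)
open import Data.Fin using (Fin; toℕ)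
open import Data.Vec using (Vec; []; _∷_; lookup; tabulate; toList)
open import Data.List using (List; []; _∷_)
open import Data.Maybe using (Maybe; just; nothing; fromMaybe)
open import Data.Product using (_×_)
open import Relation.Binary.PropositionalEquality using (_≡_)
open import Relation.Nullary using (¬_)

-- A permutation of [n] in one-line notation: the word π₁⋯πₙ, stored as a
-- vector of entries in Fin n (value k ∈ Fin n stands for k+1 ∈ [n]),
-- required to be injective (hence bijective, since n is finite).
IsPerm : ∀ {n} → Vec (Fin n) n → Set
IsPerm {n} π = ∀ (i j : Fin n) → lookup π i ≡ lookup π j → i ≡ j

desList : List ℕ → ℕ
desList [] = 0
desList (x ∷ []) = 0
desList (x ∷ y ∷ w) = (if y <ᵇ x then 1 else 0) + desList (y ∷ w)

des : ∀ {n} → Vec (Fin n) n → ℕ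
des π = desList (Data.List.map toℕ (toList π))

indexOf : ∀ {n m} → Fin m → Vec (Fin m) n → Maybe (Fin n)
indexOf k [] = nothing
indexOf k (x ∷ v) with toℕ x Data.Nat.≟ toℕ k
... | Relation.Nullary.yes _ = just Data.Fin.zero
... | Relation.Nullary.no _ = Data.Maybe.map Data.Fin.suc (indexOf k v)

-- The inverse permutation π⁻¹ in one-line notation: (π⁻¹)_k = the position
-- i with π_i = k.  (For a permutation this position always exists; the
-- default value k is never used.)
inverse : ∀ {n} → Vec (Fin n) n → Vec (Fin n) n
inverse π = tabulate (λ k → fromMaybe k (indexOf k π))

ides : ∀ {n} → Vec (Fin n) n → ℕ
ides π = des (inverse π)

data Has123 : List ℕ → Set where
  here  : ∀ {x y z w} → x < y → y < z → Has123 (x ∷ y ∷ z ∷ w)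
  there : ∀ {x w} → Has123 w → Has123 (x ∷ w)

Avoids123 : ∀ {n} → Vec (Fin n) n → Set
Avoids123 π = ¬ Has123 (Data.List.map toℕ (toList π))

-- If ides π = 1, every inversion of π pairs a value below a cut s with a value at
-- least s (s − 1 is the descent of π⁻¹).  So π is the shuffle of the increasing runs
-- 0, …, s − 1 and s, …, n − 1 along the 0/1 word t marking the positions of the large
-- values, and π determines s and t.  The descents of such a shuffle sit exactly at the
-- factors 10 of t, so π avoids a consecutive 123 iff every three consecutive letters
-- of t contain a factor 10.  For n ≥ 3 these words are 0101…, 1010…, 11010… and the
-- same words with their last letter set to 0; this gives a new word only when the
-- last letter was 1, which happens for one of the three words when n is odd and for
-- two of them when n is even.

module Submission where

open import Defs
open import Data.Nat
  using (ℕ; zero; suc; _≤_; _<_; _+_; _*_; _≤?_; _<?_; _<ᵇ_; _≡ᵇ_; z≤n; s≤s; z<s)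
open import Data.Nat.Properties
open import Data.Bool using (Bool; true; false; not; if_then_else_; T)
open import Data.Bool.Properties using (not-involutive; not-¬)
open import Data.Unit using (tt)
open import Data.Fin using (Fin; toℕ; fromℕ<; punchOut) renaming (zero to fzero; suc to fsuc)
import Data.Fin.Properties as Fin
open import Data.Vec using (Vec; []; _∷_; lookup; tabulate; toList)
import Data.Vec.Properties as Vec
open import Data.Maybe using (just; fromMaybe)
open import Data.List using (List; []; _∷_; length; map)
open import Data.List.Properties using (length-map)
open import Data.List.Relation.Unary.All as All using (All; []; _∷_)
import Data.List.Relation.Unary.All.Properties as All
open import Data.List.Relation.Unary.Any using (Any; here; there)
open import Data.List.Relation.Unary.AllPairs using (AllPairs; []; _∷_)
open import Data.List.Relation.Unary.Unique.Propositional using (Unique)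
open import Data.List.Membership.Propositional using (_∈_; find)
open import Data.List.Membership.Propositional.Properties using (∈-map⁺; ∈-map⁻)
open import Data.Product using (Σ; _×_; _,_; proj₁; proj₂; ∃; ∃₂)
open import Data.Sum using (_⊎_; inj₁; inj₂)
open import Function using (_∘_)
open import Function.Bundles using (_⇔_; mk⇔)
open import Relation.Binary.PropositionalEquality
open import Relation.Binary.Definitions using (tri<; tri≈; tri>)
open import Relation.Nullary using (Dec; yes; no; does; ¬_; contradiction)
open import Relation.Nullary.Reflects using (ofʸ; ofⁿ)
open import Relation.Nullary.Decidable using (dec-true; dec-false)
open import Algebra.Properties.CommutativeSemigroup +-commutativeSemigroup using (xy∙z≈xz∙y)

AgreeOn : {A : Set} → ℕ → (ℕ → A) → (ℕ → A) → Set
AgreeOn n f g = ∀ i → i < n → f i ≡ g i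

AgreeOn-trans : ∀ {A : Set} {n} {f g h : ℕ → A} → AgreeOn n f g → AgreeOn n g h → AgreeOn n f h
AgreeOn-trans f≗g g≗h i i<n = trans (f≗g i i<n) (g≗h i i<n)

does⇒ : {A : Set} (a? : Dec A) → does a? ≡ true → A
does⇒ (yes a) _ = a

¬does⇒ : {A : Set} (a? : Dec A) → does a? ≡ false → ¬ A
¬does⇒ (no ¬a) _ = ¬a

not≡true⇒≡false : ∀ {b} → not b ≡ true → b ≡ false
not≡true⇒≡false {false} _ = refl

count : (ℕ → Bool) → ℕ → ℕ
count t zero = 0
count t (suc i) = if t i then suc (count t i) else count t i

count-true : ∀ t i → t i ≡ true → count t (suc i) ≡ suc (count t i)
count-true t i ti rewrite ti = refl

count-step : ∀ t i → count t i ≤ count t (suc i)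
count-step t i with t i
... | true = n≤1+n (count t i)
... | false = ≤-refl

count-mono : ∀ t {i j} → i ≤ j → count t i ≤ count t j
count-mono t {j = zero} z≤n = ≤-refl
count-mono t {i} {suc j} i≤1+j with m≤n⇒m<n∨m≡n i≤1+j
... | inj₁ (s≤s i≤j) = ≤-trans (count-mono t i≤j) (count-step t j)
... | inj₂ refl = ≤-refl

count-< : ∀ t {i j} → i < j → t i ≡ true → count t i < count t j
count-< t {i} i<j ti = subst (_≤ _) (count-true t i ti) (count-mono t i<j)

count-≤ : ∀ t i → count t i ≤ i
count-≤ t zero = z≤n
count-≤ t (suc i) with t i
... | true = s≤s (count-≤ t i)
... | false = m≤n⇒m≤1+n (count-≤ t i)

count-not+count : ∀ t i → count (not ∘ t) i + count t i ≡ i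
count-not+count t zero = refl
count-not+count t (suc i) with t i
... | true = trans (+-suc (count (not ∘ t) i) (count t i)) (cong suc (count-not+count t i))
... | false = cong suc (count-not+count t i)

count-cong : ∀ {n} t u → AgreeOn n t u → ∀ i → i ≤ n → count t i ≡ count u i
count-cong t u t≗u zero _ = refl
count-cong t u t≗u (suc i) i<n rewrite t≗u i i<n | count-cong t u t≗u i (<⇒≤ i<n) = refl

count-positive : ∀ t m → 0 < count t m → ∃ λ p → p < m × t p ≡ true
count-positive t (suc m) pos with t m in tm
... | true = m , ≤-refl , tm
... | false with count-positive t m pos
...   | p , p<m , tp = p , m<n⇒m<1+n p<m , tp

module IncreasingOn (S : ℕ → Bool) (w : ℕ → ℕ) (n lo hi : ℕ)
  (increasing : ∀ p q → p < q → q < n → S p ≡ true → S q ≡ true → w p < w q)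
  (lo≤ : ∀ p → p < n → S p ≡ true → lo ≤ w p)
  (<hi : ∀ p → p < n → S p ≡ true → w p < hi) where

  count-lower : ∀ p → p < n → S p ≡ true → lo + count S p ≤ w p
  count-lower p = below-selected p p ≤-refl
    where
    below-selected : ∀ i q → i ≤ q → q < n → S q ≡ true → lo + count S i ≤ w q
    below-selected zero q _ q<n Sq = subst (_≤ w q) (sym (+-identityʳ lo)) (lo≤ q q<n Sq)
    below-selected (suc i) q i<q q<n Sq with S i in Si
    ... | true = begin
      lo + suc (count S i) ≡⟨ +-suc lo (count S i) ⟩
      suc (lo + count S i) ≤⟨ s≤s (below-selected i i ≤-refl (<-trans i<q q<n) Si) ⟩
      suc (w i)            ≤⟨ increasing i q i<q q<n Si Sq ⟩
      w q                  ∎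
      where open ≤-Reasoning
    ... | false = below-selected i q (<⇒≤ i<q) q<n Sq

  last-selected-below : ∀ p → S p ≡ true → ∀ i → p < i → i ≤ n →
    ∃ λ q → q < i × S q ≡ true × w p + count S i ≤ suc (w q) + count S p
  last-selected-below p Sp (suc i) (s≤s p≤i) i≤n with m≤n⇒m<n∨m≡n p≤i
  ... | inj₂ refl = p , ≤-refl , Sp , ≤-reflexive (begin-equality
    w p + count S (suc p)  ≡⟨ cong (w p +_) (count-true S p Sp) ⟩
    w p + suc (count S p)  ≡⟨ +-suc (w p) (count S p) ⟩
    suc (w p) + count S p  ∎)
    where open ≤-Reasoning
  ... | inj₁ p<i with last-selected-below p Sp i p<i (<⇒≤ i≤n) | S i in Si
  ...   | q , q<i , Sq , bound | false = q , m<n⇒m<1+n q<i , Sq , bound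
  ...   | q , q<i , Sq , bound | true = i , ≤-refl , Si , (begin
    w p + suc (count S i)       ≡⟨ +-suc (w p) (count S i) ⟩
    suc (w p + count S i)       ≤⟨ s≤s bound ⟩
    suc (suc (w q) + count S p) ≤⟨ s≤s (+-monoˡ-≤ (count S p) (increasing q i q<i i≤n Sq Si)) ⟩
    suc (w i) + count S p       ∎)
    where open ≤-Reasoning

  count-upper : ∀ p → p < n → S p ≡ true → w p + count S n ≤ hi + count S p
  count-upper p p<n Sp with last-selected-below p Sp n p<n ≤-refl
  ... | q , q<n , Sq , bound = ≤-trans bound (+-monoˡ-≤ (count S p) (<hi q q<n Sq))

  count-bound : lo ≤ hi → lo + count S n ≤ hi
  count-bound lo≤hi with count S n in #S
  ... | zero = subst (_≤ hi) (sym (+-identityʳ lo)) lo≤hi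
  ... | suc c with count-positive S n (subst (0 <_) (sym #S) z<s)
  ...   | p , p<n , Sp = +-cancelʳ-≤ (count S p) (lo + suc c) hi (begin
    lo + suc c + count S p ≡⟨ xy∙z≈xz∙y lo (suc c) (count S p) ⟩
    lo + count S p + suc c ≤⟨ +-monoˡ-≤ (suc c) (count-lower p p<n Sp) ⟩
    w p + suc c            ≡⟨ cong (w p +_) (sym #S) ⟩
    w p + count S n        ≤⟨ count-upper p p<n Sp ⟩
    hi + count S p         ∎)
    where open ≤-Reasoning

-- Shuffles of two increasing runs

Straddles : (ℕ → ℕ) → ℕ → ℕ → Set
Straddles w n s = ∀ i j → i < j → j < n → w j < w i → w j < s × s ≤ w i

HasInversion : (ℕ → ℕ) → ℕ → Set
HasInversion w n = ∃₂ λ i j → i < j × j < n × w j < w i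

Straddles-cong : ∀ {w w′ n s} → AgreeOn n w w′ → Straddles w n s → Straddles w′ n s
Straddles-cong {w} {w′} w≗w′ straddles i j i<j j<n lt
  rewrite sym (w≗w′ i (<-trans i<j j<n)) | sym (w≗w′ j j<n) = straddles i j i<j j<n lt

HasInversion-cong : ∀ {w w′ n} → AgreeOn n w w′ → HasInversion w n → HasInversion w′ n
HasInversion-cong w≗w′ (i , j , i<j , j<n , lt) =
  i , j , i<j , j<n , subst₂ _<_ (w≗w′ j j<n) (w≗w′ i (<-trans i<j j<n)) lt

shuffle : (ℕ → Bool) → ℕ → ℕ → ℕ
shuffle t n i = if t i then count (not ∘ t) n + count t i else count (not ∘ t) i

module Shuffle (t : ℕ → Bool) (n : ℕ) where

  lows : ℕ
  lows = count (not ∘ t) n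

  shuffle-low : ∀ {i} → i < n → t i ≡ false → shuffle t n i < lows
  shuffle-low {i} i<n ti rewrite ti = count-< (not ∘ t) i<n (cong not ti)

  shuffle-high : ∀ {i} → t i ≡ true → lows ≤ shuffle t n i
  shuffle-high {i} ti rewrite ti = m≤m+n lows (count t i)

  shuffle-< : ∀ i → i < n → shuffle t n i < n
  shuffle-< i i<n with t i in ti
  ... | false = <-≤-trans (count-< (not ∘ t) i<n (cong not ti)) (count-≤ (not ∘ t) n)
  ... | true = <-≤-trans (+-monoʳ-< lows (count-< t i<n ti)) (≤-reflexive (count-not+count t n))

  shuffle-compare : ∀ {i j} → i < j → j < n →
    shuffle t n i < shuffle t n j ⊎ (t i ≡ true × t j ≡ false × shuffle t n j < shuffle t n i)
  shuffle-compare {i} {j} i<j j<n with t i in ti | t j in tj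
  ... | true  | true  = inj₁ (+-monoʳ-< lows (count-< t i<j ti))
  ... | false | false = inj₁ (count-< (not ∘ t) i<j (cong not ti))
  ... | false | true  =
    inj₁ (<-≤-trans (count-< (not ∘ t) (<-trans i<j j<n) (cong not ti)) (m≤m+n lows _))
  ... | true  | false =
    inj₂ (refl , refl , <-≤-trans (count-< (not ∘ t) j<n (cong not tj)) (m≤m+n lows _))

  shuffle-≢ : ∀ {i j} → i < j → j < n → shuffle t n i ≢ shuffle t n j
  shuffle-≢ i<j j<n with shuffle-compare i<j j<n
  ... | inj₁ lt = <⇒≢ lt
  ... | inj₂ (_ , _ , gt) = ≢-sym (<⇒≢ gt)

  shuffle-injective : ∀ i j → i < n → j < n → shuffle t n i ≡ shuffle t n j → i ≡ j
  shuffle-injective i j i<n j<n eq with <-cmp i j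
  ... | tri< i<j _ _ = contradiction eq (shuffle-≢ i<j j<n)
  ... | tri≈ _ i≡j _ = i≡j
  ... | tri> _ _ j<i = contradiction (sym eq) (shuffle-≢ j<i i<n)

  shuffle-straddles : Straddles (shuffle t n) n lows
  shuffle-straddles i j i<j j<n gt with shuffle-compare i<j j<n
  ... | inj₁ lt = contradiction gt (<-asym lt)
  ... | inj₂ (ti , tj , _) = shuffle-low j<n tj , shuffle-high ti

shuffle-cong : ∀ {n} t u → AgreeOn n t u → AgreeOn n (shuffle t n) (shuffle u n)
shuffle-cong {n} t u t≗u i i<n
  rewrite t≗u i i<n
        | count-cong (not ∘ t) (not ∘ u) (λ j j<n → cong not (t≗u j j<n)) n ≤-refl
        | count-cong (not ∘ t) (not ∘ u) (λ j j<n → cong not (t≗u j j<n)) i (<⇒≤ i<n)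
        | count-cong t u t≗u i (<⇒≤ i<n) = refl

-- Both classes of positions carry increasing runs, inside [0, s) and [s, n); the
-- counting bounds leave no room, so each run fills its interval exactly.
module Recover (w : ℕ → ℕ) (n s : ℕ)
  (w-injective : ∀ i j → i < n → j < n → w i ≡ w j → i ≡ j)
  (w-< : ∀ i → i < n → w i < n)
  (straddles : Straddles w n s)
  (s≤n : s ≤ n) where

  high : ℕ → Bool
  high i = does (s ≤? w i)

  ascending : ∀ {p q} → p < q → q < n → ¬ (w q < s × s ≤ w p) → w p < w q
  ascending {p} {q} p<q q<n ¬straddle with <-cmp (w p) (w q)
  ... | tri< lt _ _ = lt
  ... | tri≈ _ eq _ = contradiction (w-injective p q (<-trans p<q q<n) q<n eq) (<⇒≢ p<q)
  ... | tri> _ _ gt = contradiction (straddles p q p<q q<n gt) ¬straddle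

  module Low = IncreasingOn (not ∘ high) w n 0 s
    (λ p q p<q q<n lp _ → ascending p<q q<n
      λ (_ , s≤wp) → ¬does⇒ (s ≤? w p) (not≡true⇒≡false lp) s≤wp)
    (λ _ _ _ → z≤n)
    (λ p _ lp → ≰⇒> (¬does⇒ (s ≤? w p) (not≡true⇒≡false lp)))

  module High = IncreasingOn high w n s n
    (λ p q p<q q<n _ hq → ascending p<q q<n λ (wq<s , _) → <⇒≱ wq<s (does⇒ (s ≤? w q) hq))
    (λ p _ hp → does⇒ (s ≤? w p) hp)
    (λ p p<n _ → w-< p p<n)

  lows≡s : count (not ∘ high) n ≡ s
  lows≡s = ≤-antisym (Low.count-bound z≤n)
    (+-cancelʳ-≤ (count high n) s (count (not ∘ high) n)
      (≤-trans (High.count-bound s≤n) (≤-reflexive (sym (count-not+count high n)))))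

  shuffle-recovers : AgreeOn n w (shuffle high n)
  shuffle-recovers i i<n with high i in hi
  ... | true = trans (≤-antisym upper (High.count-lower i i<n hi)) (cong (_+ count high i) (sym lows≡s))
    where
    upper : w i ≤ s + count high i
    upper = +-cancelʳ-≤ (count high n) (w i) (s + count high i) (begin
      w i + count high n
        ≤⟨ High.count-upper i i<n hi ⟩
      n + count high i
        ≡⟨ cong (_+ count high i) (sym (count-not+count high n)) ⟩
      count (not ∘ high) n + count high n + count high i
        ≡⟨ cong (λ a → a + count high n + count high i) lows≡s ⟩
      s + count high n + count high i
        ≡⟨ xy∙z≈xz∙y s (count high n) (count high i) ⟩
      s + count high i + count high n
        ∎)
      where open ≤-Reasoning
  ... | false = ≤-antisym upper (Low.count-lower i i<n (cong not hi))
    where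
    upper : w i ≤ count (not ∘ high) i
    upper = +-cancelʳ-≤ s (w i) (count (not ∘ high) i) (begin
      w i + s                      ≡⟨ cong (w i +_) (sym lows≡s) ⟩
      w i + count (not ∘ high) n   ≤⟨ Low.count-upper i i<n (cong not hi) ⟩
      s + count (not ∘ high) i     ≡⟨ +-comm s (count (not ∘ high) i) ⟩
      count (not ∘ high) i + s     ∎)
      where open ≤-Reasoning

-- Descents and double ascents of words

get : List ℕ → ℕ → ℕ
get [] _ = 0
get (x ∷ w) zero = x
get (x ∷ w) (suc i) = get w i

Descent : List ℕ → ℕ → Set
Descent w e = suc e < length w × get w (suc e) < get w e

UniqueDescent : List ℕ → ℕ → Set
UniqueDescent w d = Descent w d × (∀ e → Descent w e → e ≡ d)

desList-step : ∀ x y w →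
  (y < x × desList (x ∷ y ∷ w) ≡ suc (desList (y ∷ w))) ⊎
  (¬ y < x × desList (x ∷ y ∷ w) ≡ desList (y ∷ w))
desList-step x y w with y <ᵇ x | <ᵇ-reflects-< y x
... | true | ofʸ y<x = inj₁ (y<x , refl)
... | false | ofⁿ y≮x = inj₂ (y≮x , refl)

desList≡0⇒¬Descent : ∀ w → desList w ≡ 0 → ∀ e → ¬ Descent w e
desList≡0⇒¬Descent (x ∷ []) _ e (s≤s () , _)
desList≡0⇒¬Descent (x ∷ y ∷ w) des≡0 e de
  with desList-step x y w | desList≡0⇒¬Descent (y ∷ w)
... | inj₁ (_ , des≡1+) | _ = 0≢1+n (trans (sym des≡0) des≡1+)
... | inj₂ (y≮x , des≡) | rec with e | de
...   | zero  | (_ , lt) = y≮x lt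
...   | suc e | (s≤s l , lt) = rec (trans (sym des≡) des≡0) e (l , lt)

¬Descent⇒desList≡0 : ∀ w → (∀ e → ¬ Descent w e) → desList w ≡ 0
¬Descent⇒desList≡0 [] _ = refl
¬Descent⇒desList≡0 (x ∷ []) _ = refl
¬Descent⇒desList≡0 (x ∷ y ∷ w) none with desList-step x y w | ¬Descent⇒desList≡0 (y ∷ w)
... | inj₁ (y<x , _) | _ = contradiction (s≤s (s≤s z≤n) , y<x) (none 0)
... | inj₂ (_ , des≡) | rec = trans des≡ (rec λ e (l , lt) → none (suc e) (s≤s l , lt))

desList≡1⇒UniqueDescent : ∀ w → desList w ≡ 1 → ∃ (UniqueDescent w)
desList≡1⇒UniqueDescent (x ∷ y ∷ w) des≡1
  with desList-step x y w | desList≡1⇒UniqueDescent (y ∷ w)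
... | inj₁ (y<x , des≡1+) | _ = 0 , (s≤s (s≤s z≤n) , y<x) , unique
  where
  unique : ∀ e → Descent (x ∷ y ∷ w) e → e ≡ 0
  unique zero _ = refl
  unique (suc e) (s≤s l , lt) =
    contradiction (l , lt) (desList≡0⇒¬Descent (y ∷ w) (suc-injective (trans (sym des≡1+) des≡1)) e)
... | inj₂ (y≮x , des≡) | rec with rec (trans (sym des≡) des≡1)
...   | d , (l , lt) , unique = suc d , (s≤s l , lt) , unique′
  where
  unique′ : ∀ e → Descent (x ∷ y ∷ w) e → e ≡ suc d
  unique′ zero (_ , lt′) = contradiction lt′ y≮x
  unique′ (suc e) (s≤s l′ , lt′) = cong suc (unique e (l′ , lt′))

UniqueDescent⇒desList≡1 : ∀ w d → UniqueDescent w d → desList w ≡ 1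
UniqueDescent⇒desList≡1 (x ∷ []) d ((s≤s () , _) , _)
UniqueDescent⇒desList≡1 (x ∷ y ∷ w) d (de , unique)
  with desList-step x y w | UniqueDescent⇒desList≡1 (y ∷ w)
... | inj₁ (y<x , des≡1+) | _ = trans des≡1+ (cong suc (¬Descent⇒desList≡0 (y ∷ w) λ e (l , lt) →
  0≢1+n (trans (unique 0 (s≤s (s≤s z≤n) , y<x)) (sym (unique (suc e) (s≤s l , lt))))))
... | inj₂ (y≮x , des≡) | rec with d | de
...   | zero  | (_ , lt) = contradiction lt y≮x
...   | suc d | (s≤s l , lt) =
  trans des≡ (rec d ((l , lt) , λ e (l′ , lt′) → suc-injective (unique (suc e) (s≤s l′ , lt′))))

descent-between : ∀ w x y → x ≤ y → y < length w → get w y < get w x →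
  ∃ λ e → x ≤ e × e < y × Descent w e
descent-between w x zero z≤n _ lt = contradiction lt (<-irrefl refl)
descent-between w x (suc y) x≤1+y 1+y<len lt with m≤n⇒m<n∨m≡n x≤1+y
... | inj₂ refl = contradiction lt (<-irrefl refl)
... | inj₁ (s≤s x≤y) with get w (suc y) <? get w y
...   | yes de = y , x≤y , ≤-refl , 1+y<len , de
...   | no ¬de with descent-between w x y x≤y (<-trans (n<1+n y) 1+y<len) (≤-<-trans (≮⇒≥ ¬de) lt)
...     | e , x≤e , e<y , de = e , x≤e , m<n⇒m<1+n e<y , de

DoubleAscent : List ℕ → ℕ → Set
DoubleAscent w i = suc (suc i) < length w × get w i < get w (suc i) × get w (suc i) < get w (suc (suc i))

Has123⇒DoubleAscent : ∀ w → Has123 w → ∃ (DoubleAscent w)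
Has123⇒DoubleAscent (x ∷ y ∷ z ∷ w) (here x<y y<z) = 0 , s≤s (s≤s (s≤s z≤n)) , x<y , y<z
Has123⇒DoubleAscent (x ∷ w) (there has) with Has123⇒DoubleAscent w has
... | i , l , a , b = suc i , s≤s l , a , b

DoubleAscent⇒Has123 : ∀ w i → DoubleAscent w i → Has123 w
DoubleAscent⇒Has123 (x ∷ y ∷ z ∷ w) zero (_ , x<y , y<z) = here x<y y<z
DoubleAscent⇒Has123 (x ∷ w) (suc i) (s≤s l , a , b) = there (DoubleAscent⇒Has123 w i (l , a , b))

word : ∀ {n m} → Vec (Fin m) n → List ℕ
word v = map toℕ (toList v)

length-word : ∀ {n m} (v : Vec (Fin m) n) → length (word v) ≡ n
length-word [] = refl
length-word (x ∷ v) = cong suc (length-word v)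

get-word : ∀ {n m} (v : Vec (Fin m) n) (i : Fin n) → get (word v) (toℕ i) ≡ toℕ (lookup v i)
get-word (x ∷ v) fzero = refl
get-word (x ∷ v) (fsuc i) = get-word v i

entry : ∀ {n m} → Vec (Fin m) n → ℕ → ℕ
entry v = get (word v)

entry-fromℕ< : ∀ {n m} (v : Vec (Fin m) n) {i} (i<n : i < n) →
  entry v i ≡ toℕ (lookup v (fromℕ< i<n))
entry-fromℕ< v {i} i<n = trans (cong (entry v) (sym (Fin.toℕ-fromℕ< i<n))) (get-word v (fromℕ< i<n))

entry-< : ∀ {n m} (v : Vec (Fin m) n) i → i < n → entry v i < m
entry-< v i i<n = subst (_< _) (sym (entry-fromℕ< v i<n)) (Fin.toℕ<n _)

≗entry⇒≡ : ∀ {n m} (u v : Vec (Fin m) n) → AgreeOn n (entry u) (entry v) → u ≡ v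
≗entry⇒≡ u v u≗v = begin
  u                  ≡⟨ Vec.tabulate∘lookup u ⟨
  tabulate (lookup u) ≡⟨ Vec.tabulate-cong (λ p → Fin.toℕ-injective (begin
    toℕ (lookup u p) ≡⟨ get-word u p ⟨
    entry u (toℕ p)  ≡⟨ u≗v (toℕ p) (Fin.toℕ<n p) ⟩
    entry v (toℕ p)  ≡⟨ get-word v p ⟩
    toℕ (lookup v p) ∎)) ⟩
  tabulate (lookup v) ≡⟨ Vec.tabulate∘lookup v ⟩
  v                  ∎
  where open ≡-Reasoning

indexOf-sound : ∀ {n m} (k : Fin m) (v : Vec (Fin m) n) j → indexOf k v ≡ just j → lookup v j ≡ k
indexOf-sound k (x ∷ v) j found with toℕ x Data.Nat.≟ toℕ k
indexOf-sound k (x ∷ v) fzero refl | yes x≡k = Fin.toℕ-injective x≡k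
... | no _ with indexOf k v in found′
indexOf-sound k (x ∷ v) (fsuc j) refl | no _ | just j = indexOf-sound k v j found′

indexOf-complete : ∀ {n m} (k : Fin m) (v : Vec (Fin m) n) i →
  lookup v i ≡ k → ∃ λ j → indexOf k v ≡ just j
indexOf-complete k (x ∷ v) i v[i]≡k with toℕ x Data.Nat.≟ toℕ k
... | yes _ = fzero , refl
indexOf-complete k (x ∷ v) fzero x≡k | no x≢k = contradiction (cong toℕ x≡k) x≢k
indexOf-complete k (x ∷ v) (fsuc i) v[i]≡k | no _ with indexOf-complete k v i v[i]≡k
... | j , found rewrite found = fsuc j , refl

lookup-inverse : ∀ {n} (π : Vec (Fin n) n) → IsPerm π →
  ∀ i k → lookup π i ≡ k → lookup (inverse π) k ≡ i
lookup-inverse π perm i k π[i]≡k with indexOf-complete k π i π[i]≡k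
... | j , found = begin
  lookup (inverse π) k         ≡⟨ Vec.lookup∘tabulate _ k ⟩
  fromMaybe k (indexOf k π)    ≡⟨ cong (fromMaybe k) found ⟩
  j                            ≡⟨ perm j i (trans (indexOf-sound k π j found) (sym π[i]≡k)) ⟩
  i                            ∎
  where open ≡-Reasoning

perm-surjective : ∀ {n} (π : Vec (Fin n) n) → IsPerm π → ∀ k → ∃ λ i → lookup π i ≡ k
perm-surjective {suc m} π perm k with Fin.any? (λ i → lookup π i Fin.≟ k)
... | yes hit = hit
... | no miss with Fin.pigeonhole (n<1+n m) (λ i → punchOut {i = k} {j = lookup π i} (miss ∘ (i ,_) ∘ sym))
...   | i , j , i<j , eq = contradiction
  (perm i j (Fin.punchOut-injective (miss ∘ (i ,_) ∘ sym) (miss ∘ (j ,_) ∘ sym) eq)) (Fin.<⇒≢ i<j)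

module Permutation {n} (π : Vec (Fin n) n) (perm : IsPerm π) where

  entry-injective : ∀ i j → i < n → j < n → entry π i ≡ entry π j → i ≡ j
  entry-injective i j i<n j<n eq = begin
    i                        ≡⟨ Fin.toℕ-fromℕ< i<n ⟨
    toℕ (fromℕ< i<n)         ≡⟨ cong toℕ (perm _ _ (Fin.toℕ-injective lookups≡)) ⟩
    toℕ (fromℕ< j<n)         ≡⟨ Fin.toℕ-fromℕ< j<n ⟩
    j                        ∎
    where
    open ≡-Reasoning
    lookups≡ : toℕ (lookup π (fromℕ< i<n)) ≡ toℕ (lookup π (fromℕ< j<n))
    lookups≡ = trans (sym (entry-fromℕ< π i<n)) (trans eq (entry-fromℕ< π j<n))

  entry-surjective : ∀ k → k < n → ∃ λ i → i < n × entry π i ≡ k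
  entry-surjective k k<n with perm-surjective π perm (fromℕ< k<n)
  ... | p , π[p]≡k = toℕ p , Fin.toℕ<n p ,
    trans (get-word π p) (trans (cong toℕ π[p]≡k) (Fin.toℕ-fromℕ< k<n))

  invWord : List ℕ
  invWord = word (inverse π)

  get-invWord : ∀ i → i < n → get invWord (entry π i) ≡ i
  get-invWord i i<n = begin
    get invWord (entry π i)                              ≡⟨ cong (get invWord) (entry-fromℕ< π i<n) ⟩
    get invWord (toℕ (lookup π (fromℕ< i<n)))            ≡⟨ get-word (inverse π) _ ⟩
    toℕ (lookup (inverse π) (lookup π (fromℕ< i<n)))     ≡⟨ cong toℕ (lookup-inverse π perm _ _ refl) ⟩
    toℕ (fromℕ< i<n)                                     ≡⟨ Fin.toℕ-fromℕ< i<n ⟩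
    i                                                    ∎
    where open ≡-Reasoning

  inversion⇒Descent : ∀ {i j} → i < j → j < n → entry π j < entry π i →
    ∃ λ e → entry π j ≤ e × e < entry π i × Descent invWord e
  inversion⇒Descent {i} {j} i<j j<n lt = descent-between invWord (entry π j) (entry π i) (<⇒≤ lt)
    (subst (entry π i <_) (sym (length-word (inverse π))) (entry-< π i (<-trans i<j j<n)))
    (subst₂ _<_ (sym (get-invWord i (<-trans i<j j<n))) (sym (get-invWord j j<n)) i<j)

  invWord-section : ∀ k → k < n → get invWord k < n × entry π (get invWord k) ≡ k
  invWord-section k k<n with entry-surjective k k<n
  ... | i , i<n , refl rewrite get-invWord i i<n = i<n , refl

  Straddles⇒Descent≡ : ∀ {s} → Straddles (entry π) n s → ∀ e → Descent invWord e → suc e ≡ s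
  Straddles⇒Descent≡ {s} straddles e (1+e<len , q<p) =
    squeeze (straddles q p q<p p<n (subst₂ _<_ (sym π[p]≡e) (sym π[q]≡1+e) (n<1+n e)))
    where
    1+e<n : suc e < n
    1+e<n = subst (suc e <_) (length-word (inverse π)) 1+e<len
    p q : ℕ
    p = get invWord e
    q = get invWord (suc e)
    p<n : p < n
    p<n = proj₁ (invWord-section e (<-trans (n<1+n e) 1+e<n))
    π[p]≡e : entry π p ≡ e
    π[p]≡e = proj₂ (invWord-section e (<-trans (n<1+n e) 1+e<n))
    π[q]≡1+e : entry π q ≡ suc e
    π[q]≡1+e = proj₂ (invWord-section (suc e) 1+e<n)
    squeeze : entry π p < s × s ≤ entry π q → suc e ≡ s
    squeeze (π[p]<s , s≤π[q]) = ≤-antisym (subst (_< s) π[p]≡e π[p]<s) (subst (s ≤_) π[q]≡1+e s≤π[q])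

  ides≡1⇒Straddles : ides π ≡ 1 → ∃ λ s → s < n × Straddles (entry π) n s
  ides≡1⇒Straddles ides≡1 with desList≡1⇒UniqueDescent invWord ides≡1
  ... | d , (1+d<len , _) , unique = suc d , subst (suc d <_) (length-word (inverse π)) 1+d<len , straddles
    where
    straddles : Straddles (entry π) n (suc d)
    straddles i j i<j j<n lt with inversion⇒Descent i<j j<n lt
    ... | e , π[j]≤e , e<π[i] , de rewrite unique e de = s≤s π[j]≤e , e<π[i]

  Straddles⇒ides≡1 : ∀ {s} → Straddles (entry π) n s → HasInversion (entry π) n → ides π ≡ 1
  Straddles⇒ides≡1 straddles (i , j , i<j , j<n , lt) with inversion⇒Descent i<j j<n lt
  ... | e , _ , _ , de = UniqueDescent⇒desList≡1 invWord e (de , λ e′ de′ →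
    suc-injective (trans (Straddles⇒Descent≡ straddles e′ de′) (sym (Straddles⇒Descent≡ straddles e de))))

  Straddles-unique : ∀ {s s′} → Straddles (entry π) n s → Straddles (entry π) n s′ →
    HasInversion (entry π) n → s ≡ s′
  Straddles-unique straddles straddles′ (i , j , i<j , j<n , lt) with inversion⇒Descent i<j j<n lt
  ... | e , _ , _ , de = trans (sym (Straddles⇒Descent≡ straddles e de)) (Straddles⇒Descent≡ straddles′ e de)

-- Admissible permutations as shuffles

HighLow : (ℕ → Bool) → ℕ → Set
HighLow t i = t i ≡ true × t (suc i) ≡ false

Window : ℕ → (ℕ → Bool) → Set
Window n t = ∀ i → suc (suc i) < n → HighLow t i ⊎ HighLow t (suc i)

module ShuffleWindow (t : ℕ → Bool) (n : ℕ) (window : Window n t) where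
  open Shuffle t n

  HighLow⇒descent : ∀ {i} → suc i < n → HighLow t i → shuffle t n (suc i) < shuffle t n i
  HighLow⇒descent 1+i<n (ti , t[1+i]) = <-≤-trans (shuffle-low 1+i<n t[1+i]) (shuffle-high ti)

  no-double-ascent : ∀ i → suc (suc i) < n →
    ¬ (shuffle t n i < shuffle t n (suc i) × shuffle t n (suc i) < shuffle t n (suc (suc i)))
  no-double-ascent i 2+i<n (asc₁ , asc₂) with window i 2+i<n
  ... | inj₁ hl = <-asym asc₁ (HighLow⇒descent (<-trans (n<1+n _) 2+i<n) hl)
  ... | inj₂ hl = <-asym asc₂ (HighLow⇒descent 2+i<n hl)

  has-inversion : 3 ≤ n → HasInversion (shuffle t n) n
  has-inversion 3≤n with window 0 3≤n
  ... | inj₁ hl = 0 , 1 , s≤s z≤n , 1<n , HighLow⇒descent 1<n hl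
    where
    1<n : 1 < n
    1<n = <-trans (s≤s (s≤s z≤n)) 3≤n
  ... | inj₂ hl = 1 , 2 , s≤s (s≤s z≤n) , 3≤n , HighLow⇒descent 3≤n hl

shuffleVec : (n : ℕ) → (ℕ → Bool) → Vec (Fin n) n
shuffleVec n t = tabulate λ i → fromℕ< (Shuffle.shuffle-< t n (toℕ i) (Fin.toℕ<n i))

lookup-shuffleVec : ∀ n t (p : Fin n) → toℕ (lookup (shuffleVec n t) p) ≡ shuffle t n (toℕ p)
lookup-shuffleVec n t p = trans (cong toℕ (Vec.lookup∘tabulate _ p)) (Fin.toℕ-fromℕ< _)

entry-shuffleVec : ∀ n t → AgreeOn n (entry (shuffleVec n t)) (shuffle t n)
entry-shuffleVec n t i i<n = begin
  entry (shuffleVec n t) i                         ≡⟨ entry-fromℕ< (shuffleVec n t) i<n ⟩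
  toℕ (lookup (shuffleVec n t) (fromℕ< i<n))       ≡⟨ lookup-shuffleVec n t (fromℕ< i<n) ⟩
  shuffle t n (toℕ (fromℕ< i<n))                   ≡⟨ cong (shuffle t n) (Fin.toℕ-fromℕ< i<n) ⟩
  shuffle t n i                                    ∎
  where open ≡-Reasoning

Admissible : ∀ {n} → Vec (Fin n) n → Set
Admissible π = IsPerm π × Avoids123 π × ides π ≡ 1

AdmissibleList : (n k : ℕ) → Set
AdmissibleList n k =
  Σ (List (Vec (Fin n) n)) λ L → Unique L × (∀ π → π ∈ L ⇔ Admissible π) × length L ≡ k

shuffleVec-isPerm : ∀ n t → IsPerm (shuffleVec n t)
shuffleVec-isPerm n t i j eq = Fin.toℕ-injective
  (Shuffle.shuffle-injective t n (toℕ i) (toℕ j) (Fin.toℕ<n i) (Fin.toℕ<n j)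
    (trans (sym (lookup-shuffleVec n t i)) (trans (cong toℕ eq) (lookup-shuffleVec n t j))))

shuffleVec-admissible : ∀ n t → 3 ≤ n → Window n t → Admissible (shuffleVec n t)
shuffleVec-admissible n t 3≤n window = perm , avoids , ides≡1
  where
  open ShuffleWindow t n window
  π : Vec (Fin n) n
  π = shuffleVec n t
  perm : IsPerm π
  perm = shuffleVec-isPerm n t
  π≗shuffle : AgreeOn n (entry π) (shuffle t n)
  π≗shuffle = entry-shuffleVec n t

  avoids : Avoids123 π
  avoids has with Has123⇒DoubleAscent (word π) has
  ... | i , 2+i<len , asc₁ , asc₂ = no-double-ascent i 2+i<n
    ( subst₂ _<_ (π≗shuffle i i<n) (π≗shuffle (suc i) 1+i<n) asc₁
    , subst₂ _<_ (π≗shuffle (suc i) 1+i<n) (π≗shuffle (suc (suc i)) 2+i<n) asc₂)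
    where
    2+i<n : suc (suc i) < n
    2+i<n = subst (suc (suc i) <_) (length-word π) 2+i<len
    1+i<n : suc i < n
    1+i<n = <-trans (n<1+n (suc i)) 2+i<n
    i<n : i < n
    i<n = <-trans (n<1+n i) 1+i<n

  ides≡1 : ides π ≡ 1
  ides≡1 = Permutation.Straddles⇒ides≡1 π perm
    (Straddles-cong (λ i i<n → sym (π≗shuffle i i<n)) (Shuffle.shuffle-straddles t n))
    (HasInversion-cong (λ i i<n → sym (π≗shuffle i i<n)) (has-inversion 3≤n))

admissible⇒shuffle : ∀ n (π : Vec (Fin n) n) → Admissible π →
  ∃ λ t → Window n t × AgreeOn n (entry π) (shuffle t n)
admissible⇒shuffle n π (perm , avoids , ides≡1) with Permutation.ides≡1⇒Straddles π perm ides≡1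
... | s , s<n , straddles = R.high , window , R.shuffle-recovers
  where
  open Permutation π perm using (entry-injective)
  module R = Recover (entry π) n s entry-injective (entry-< π) straddles (<⇒≤ s<n)

  ascent-or-HighLow : ∀ k → suc k < n → entry π k < entry π (suc k) ⊎ HighLow R.high k
  ascent-or-HighLow k 1+k<n with <-cmp (entry π k) (entry π (suc k))
  ... | tri< asc _ _ = inj₁ asc
  ... | tri≈ _ eq _ = contradiction (entry-injective k (suc k) (<-trans (n<1+n k) 1+k<n) 1+k<n eq) (<⇒≢ (n<1+n k))
  ... | tri> _ _ desc with straddles k (suc k) (n<1+n k) 1+k<n desc
  ...   | π[1+k]<s , s≤π[k] =
    inj₂ (dec-true (s ≤? entry π k) s≤π[k] , dec-false (s ≤? entry π (suc k)) (<⇒≱ π[1+k]<s))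

  window : Window n R.high
  window i 2+i<n with ascent-or-HighLow i (<-trans (n<1+n (suc i)) 2+i<n) | ascent-or-HighLow (suc i) 2+i<n
  ... | inj₂ hl | _ = inj₁ hl
  ... | inj₁ _ | inj₂ hl = inj₂ hl
  ... | inj₁ asc₁ | inj₁ asc₂ = contradiction
    (DoubleAscent⇒Has123 (word π) i (subst (suc (suc i) <_) (sym (length-word π)) 2+i<n , asc₁ , asc₂)) avoids

shuffleVec-injective : ∀ n t u → 3 ≤ n → Window n t → shuffleVec n t ≡ shuffleVec n u → AgreeOn n t u
shuffleVec-injective n t u 3≤n window π≡π′ = agree
  where
  module T = Shuffle t n
  module U = Shuffle u n
  π : Vec (Fin n) n
  π = shuffleVec n t

  shuffle≡ : AgreeOn n (shuffle t n) (shuffle u n)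
  shuffle≡ i i<n = trans (sym (entry-shuffleVec n t i i<n))
    (trans (cong (λ π′ → entry π′ i) π≡π′) (entry-shuffleVec n u i i<n))

  lows≡ : T.lows ≡ U.lows
  lows≡ = Permutation.Straddles-unique π (shuffleVec-isPerm n t)
    (Straddles-cong (λ j j<n → sym (entry-shuffleVec n t j j<n)) T.shuffle-straddles)
    (Straddles-cong (λ j j<n → sym (trans (entry-shuffleVec n t j j<n) (shuffle≡ j j<n))) U.shuffle-straddles)
    (HasInversion-cong (λ j j<n → sym (entry-shuffleVec n t j j<n)) (ShuffleWindow.has-inversion t n window 3≤n))

  agree : AgreeOn n t u
  agree i i<n with t i in ti | u i in ui
  ... | true  | true  = refl
  ... | false | false = refl
  ... | true  | false = contradiction (begin
    U.lows         ≡⟨ lows≡ ⟨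
    T.lows         ≤⟨ T.shuffle-high ti ⟩
    shuffle t n i  ≡⟨ shuffle≡ i i<n ⟩
    shuffle u n i  ∎) (<⇒≱ (U.shuffle-low i<n ui))
    where open ≤-Reasoning
  ... | false | true = contradiction (begin
    T.lows         ≡⟨ lows≡ ⟩
    U.lows         ≤⟨ U.shuffle-high ui ⟩
    shuffle u n i  ≡⟨ shuffle≡ i i<n ⟨
    shuffle t n i  ∎) (<⇒≱ (T.shuffle-low i<n ti))
    where open ≤-Reasoning

enumeration : ∀ n → 3 ≤ n → (ws : List (ℕ → Bool)) → All (Window n) ws →
  AllPairs (λ t u → ¬ AgreeOn n t u) ws → (∀ t → Window n t → Any (AgreeOn n t) ws) →
  AdmissibleList n (length ws)
enumeration n 3≤n ws windows distinct covers =
  map (shuffleVec n) ws , unique windows distinct , (λ π → mk⇔ (sound π) (complete π)) , length-map _ ws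
  where
  unique : ∀ {ws} → All (Window n) ws → AllPairs (λ t u → ¬ AgreeOn n t u) ws →
    Unique (map (shuffleVec n) ws)
  unique [] [] = []
  unique (window ∷ windows) (apart ∷ distinct) =
    All.map⁺ (All.map (λ t≉u eq → t≉u (shuffleVec-injective n _ _ 3≤n window eq)) apart)
    ∷ unique windows distinct

  sound : ∀ π → π ∈ map (shuffleVec n) ws → Admissible π
  sound π π∈L with ∈-map⁻ (shuffleVec n) π∈L
  ... | t , t∈ws , refl = shuffleVec-admissible n t 3≤n (All.lookup windows t∈ws)

  complete : ∀ π → Admissible π → π ∈ map (shuffleVec n) ws
  complete π admissible with admissible⇒shuffle n π admissible
  ... | t , window , π≗shuffle with find (covers t window)
  ...   | u , u∈ws , t≗u = subst (_∈ _) (sym π≡) (∈-map⁺ (shuffleVec n) u∈ws)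
    where
    π≡ : π ≡ shuffleVec n u
    π≡ = ≗entry⇒≡ π (shuffleVec n u) λ i i<n →
      trans (π≗shuffle i i<n) (trans (shuffle-cong t u t≗u i i<n) (sym (entry-shuffleVec n u i i<n)))

-- Window words

odd : ℕ → Bool
odd zero = false
odd (suc i) = not (odd i)

alt₀ alt₁ alt₁₁ : ℕ → Bool
alt₀ = odd
alt₁ = not ∘ odd
alt₁₁ zero = true
alt₁₁ (suc i) = odd (suc i)

alt₀-window : ∀ n → Window n alt₀
alt₀-window n i _ with odd i
... | true = inj₁ (refl , refl)
... | false = inj₂ (refl , refl)

alt₁-window : ∀ n → Window n alt₁
alt₁-window n i _ with odd i
... | true = inj₂ (refl , refl)
... | false = inj₁ (refl , refl)

alt₁₁-window : ∀ n → Window n alt₁₁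
alt₁₁-window n zero _ = inj₂ (refl , refl)
alt₁₁-window n (suc i) = alt₀-window n (suc i)

lowerLast : ℕ → (ℕ → Bool) → ℕ → Bool
lowerLast n t i = if suc i ≡ᵇ n then false else t i

lowerLast-< : ∀ n t i → suc i < n → lowerLast n t i ≡ t i
lowerLast-< n t i 1+i<n with suc i ≡ᵇ n in eq
... | true = contradiction (≡ᵇ⇒≡ (suc i) n (subst T (sym eq) tt)) (<⇒≢ 1+i<n)
... | false = refl

lowerLast-false : ∀ n t i → t i ≡ false → lowerLast n t i ≡ false
lowerLast-false n t i ti with suc i ≡ᵇ n
... | true = refl
... | false = ti

lowerLast-last : ∀ m t → lowerLast (suc m) t m ≡ false
lowerLast-last m t with suc m ≡ᵇ suc m in eq
... | true = refl
... | false = contradiction (subst T eq (≡⇒≡ᵇ (suc m) (suc m) refl)) λ ()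

lowerLast-agrees : ∀ m t → t m ≡ false → AgreeOn (suc m) (lowerLast (suc m) t) t
lowerLast-agrees m t tm i (s≤s i≤m) with m≤n⇒m<n∨m≡n i≤m
... | inj₁ i<m = lowerLast-< (suc m) t i (s≤s i<m)
... | inj₂ refl = trans (lowerLast-last m t) (sym tm)

lowerLast-window : ∀ n t → Window n t → Window n (lowerLast n t)
lowerLast-window n t window i 2+i<n with window i 2+i<n
... | inj₁ (ti , t[1+i]) =
  inj₁ (trans (lowerLast-< n t i (<-trans (n<1+n (suc i)) 2+i<n)) ti , lowerLast-false n t (suc i) t[1+i])
... | inj₂ (t[1+i] , t[2+i]) =
  inj₂ (trans (lowerLast-< n t (suc i) 2+i<n) t[1+i] , lowerLast-false n t (suc (suc i)) t[2+i])

data Canonical (n : ℕ) (t : ℕ → Bool) : Set where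
  ≈alt₀ : AgreeOn n t alt₀ → Canonical n t
  ≈alt₁ : AgreeOn n t alt₁ → Canonical n t
  ≈alt₁₁ : AgreeOn n t alt₁₁ → Canonical n t
  ≈alt₀⁻ : AgreeOn n t (lowerLast n alt₀) → Canonical n t
  ≈alt₁⁻ : AgreeOn n t (lowerLast n alt₁) → Canonical n t
  ≈alt₁₁⁻ : AgreeOn n t (lowerLast n alt₁₁) → Canonical n t

AgreeOn-3 : ∀ {t u : ℕ → Bool} → t 0 ≡ u 0 → t 1 ≡ u 1 → t 2 ≡ u 2 → AgreeOn 3 t u
AgreeOn-3 t0 t1 t2 zero _ = t0
AgreeOn-3 t0 t1 t2 (suc zero) _ = t1
AgreeOn-3 t0 t1 t2 (suc (suc zero)) _ = t2
AgreeOn-3 t0 t1 t2 (suc (suc (suc i))) (s≤s (s≤s (s≤s ())))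

AgreeOn-∷ : ∀ {m} {t u : ℕ → Bool} →
  t 0 ≡ u 0 → AgreeOn m (t ∘ suc) (u ∘ suc) → AgreeOn (suc m) t u
AgreeOn-∷ t0 _ zero _ = t0
AgreeOn-∷ _ tail (suc i) (s≤s i<m) = tail i i<m

Window-tail : ∀ {m t} → Window (suc m) t → Window m (t ∘ suc)
Window-tail window i 2+i<m = window (suc i) (s≤s 2+i<m)

Window⇒Canonical : ∀ j t → Window (3 + j) t → Canonical (3 + j) t
Window⇒Canonical zero t window with window 0 (s≤s (s≤s (s≤s z≤n)))
... | inj₁ (t0 , t1) with t 2 in t2
...   | true = ≈alt₁ (AgreeOn-3 t0 t1 t2)
...   | false = ≈alt₁⁻ (AgreeOn-3 t0 t1 t2)
Window⇒Canonical zero t window | inj₂ (t1 , t2) with t 0 in t0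
...   | true = ≈alt₁₁ (AgreeOn-3 t0 t1 t2)
...   | false = ≈alt₀ (AgreeOn-3 t0 t1 t2)
Window⇒Canonical (suc j) t window
  with Window⇒Canonical j (t ∘ suc) (Window-tail window) | window 0 (s≤s (s≤s (s≤s z≤n)))
... | ≈alt₀ tail | inj₁ (t0 , _) =
  ≈alt₁ (AgreeOn-∷ t0 λ i i<n → trans (tail i i<n) (sym (not-involutive (odd i))))
... | ≈alt₀ tail | inj₂ (t1 , _) = contradiction (tail 0 z<s) (not-¬ t1)
... | ≈alt₁ tail | _ with t 0 in t0
...   | true = ≈alt₁₁ (AgreeOn-∷ t0 tail)
...   | false = ≈alt₀ (AgreeOn-∷ t0 tail)
Window⇒Canonical (suc j) t window | ≈alt₁₁ tail | inj₁ (_ , t1) = contradiction t1 (not-¬ (tail 0 z<s))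
Window⇒Canonical (suc j) t window | ≈alt₁₁ tail | inj₂ (_ , t2) = contradiction t2 (not-¬ (tail 1 (s≤s z<s)))
Window⇒Canonical (suc j) t window | ≈alt₀⁻ tail | inj₁ (t0 , _) =
  ≈alt₁⁻ (AgreeOn-∷ t0 λ i i<n → trans (tail i i<n) (lowered i))
  where
  lowered : ∀ i → lowerLast (3 + j) alt₀ i ≡ lowerLast (4 + j) alt₁ (suc i)
  lowered i with suc i ≡ᵇ 3 + j
  ... | true = refl
  ... | false = sym (not-involutive (odd i))
Window⇒Canonical (suc j) t window | ≈alt₀⁻ tail | inj₂ (t1 , _) = contradiction (tail 0 z<s) (not-¬ t1)
Window⇒Canonical (suc j) t window | ≈alt₁⁻ tail | _ with t 0 in t0
...   | true = ≈alt₁₁⁻ (AgreeOn-∷ t0 tail)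
...   | false = ≈alt₀⁻ (AgreeOn-∷ t0 tail)
Window⇒Canonical (suc j) t window | ≈alt₁₁⁻ tail | inj₁ (_ , t1) = contradiction t1 (not-¬ (tail 0 z<s))
Window⇒Canonical (suc j) t window | ≈alt₁₁⁻ tail | inj₂ (_ , t2) = contradiction t2 (not-¬ (tail 1 (s≤s z<s)))

disagree : ∀ {n t u} i → i < n → t i ≡ not (u i) → ¬ AgreeOn n t u
disagree i i<n ti≡¬ui t≗u = not-¬ (t≗u i i<n) ti≡¬ui

lowerLast-disagrees : ∀ m t → t m ≡ true → ¬ AgreeOn (suc m) t (lowerLast (suc m) t)
lowerLast-disagrees m t tm = disagree m ≤-refl (trans tm (cong not (sym (lowerLast-last m t))))

odd-2+ : ∀ i → odd (2 + i) ≡ odd i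
odd-2+ i = not-involutive (odd i)

odd-double : ∀ k → odd (2 * k) ≡ false
odd-double zero = refl
odd-double (suc k) = begin
  odd (2 * suc k)    ≡⟨ cong odd (*-suc 2 k) ⟩
  odd (2 + 2 * k)    ≡⟨ odd-2+ (2 * k) ⟩
  odd (2 * k)        ≡⟨ odd-double k ⟩
  false              ∎
  where open ≡-Reasoning

odd-double+1 : ∀ k → odd (2 * k + 1) ≡ true
odd-double+1 k rewrite +-comm (2 * k) 1 | odd-double k = refl

odd⇒≢double : ∀ {n} k → odd n ≡ true → n ≢ 2 * k
odd⇒≢double k n-odd n≡2k = not-¬ n-odd (trans (cong odd n≡2k) (odd-double k))

even⇒≢double+1 : ∀ {n} k → odd n ≡ false → n ≢ 2 * k + 1
even⇒≢double+1 k n-even n≡2k+1 = not-¬ (trans (cong odd n≡2k+1) (odd-double+1 k)) n-even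

module OddSize (j : ℕ) (j-even : odd j ≡ false) where
  n m : ℕ
  n = 3 + j
  m = 2 + j

  alt₀[m] : alt₀ m ≡ false
  alt₀[m] = trans (odd-2+ j) j-even

  n-odd : odd n ≡ true
  n-odd = cong not alt₀[m]

  words : List (ℕ → Bool)
  words = alt₀ ∷ alt₁ ∷ alt₁₁ ∷ lowerLast n alt₁ ∷ []

  distinct : AllPairs (λ t u → ¬ AgreeOn n t u) words
  distinct = (disagree 0 z<s refl ∷ disagree 0 z<s refl ∷ disagree 0 z<s refl ∷ [])
           ∷ (disagree 1 (s≤s z<s) refl ∷ lowerLast-disagrees m alt₁ n-odd ∷ [])
           ∷ (disagree 1 (s≤s z<s) refl ∷ [])
           ∷ [] ∷ []

  covers : ∀ t → Window n t → Any (AgreeOn n t) words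
  covers t window with Window⇒Canonical j t window
  ... | ≈alt₀ a = here a
  ... | ≈alt₁ a = there (here a)
  ... | ≈alt₁₁ a = there (there (here a))
  ... | ≈alt₁⁻ a = there (there (there (here a)))
  ... | ≈alt₀⁻ a = here (AgreeOn-trans a (lowerLast-agrees m alt₀ alt₀[m]))
  ... | ≈alt₁₁⁻ a = there (there (here (AgreeOn-trans a (lowerLast-agrees m alt₁₁ alt₀[m]))))

  enumerated : AdmissibleList n 4
  enumerated = enumeration n (s≤s (s≤s (s≤s z≤n))) words
    (alt₀-window n ∷ alt₁-window n ∷ alt₁₁-window n ∷ lowerLast-window n alt₁ (alt₁-window n) ∷ [])
    distinct covers

module EvenSize (j : ℕ) (j-odd : odd j ≡ true) where
  n m : ℕ
  n = 3 + j
  m = 2 + j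

  alt₀[m] : alt₀ m ≡ true
  alt₀[m] = trans (odd-2+ j) j-odd

  n-even : odd n ≡ false
  n-even = cong not alt₀[m]

  words : List (ℕ → Bool)
  words = alt₀ ∷ alt₁ ∷ alt₁₁ ∷ lowerLast n alt₀ ∷ lowerLast n alt₁₁ ∷ []

  distinct : AllPairs (λ t u → ¬ AgreeOn n t u) words
  distinct =
      (disagree 0 z<s refl ∷ disagree 0 z<s refl ∷ lowerLast-disagrees m alt₀ alt₀[m] ∷ disagree 0 z<s refl ∷ [])
           ∷ (disagree 1 (s≤s z<s) refl ∷ disagree 0 z<s refl ∷ disagree 1 (s≤s z<s) refl ∷ [])
           ∷ (disagree 0 z<s refl ∷ lowerLast-disagrees m alt₁₁ alt₀[m] ∷ [])
           ∷ (disagree 0 z<s refl ∷ [])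
           ∷ [] ∷ []

  covers : ∀ t → Window n t → Any (AgreeOn n t) words
  covers t window with Window⇒Canonical j t window
  ... | ≈alt₀ a = here a
  ... | ≈alt₁ a = there (here a)
  ... | ≈alt₁₁ a = there (there (here a))
  ... | ≈alt₀⁻ a = there (there (there (here a)))
  ... | ≈alt₁₁⁻ a = there (there (there (there (here a))))
  ... | ≈alt₁⁻ a = there (here (AgreeOn-trans a (lowerLast-agrees m alt₁ n-even)))

  enumerated : AdmissibleList n 5
  enumerated = enumeration n (s≤s (s≤s (s≤s z≤n))) words
    (alt₀-window n ∷ alt₁-window n ∷ alt₁₁-window n ∷ lowerLast-window n alt₀ (alt₀-window n)
      ∷ lowerLast-window n alt₁₁ (alt₁₁-window n) ∷ [])
    distinct covers

proposition4p4 : (n : ℕ) → 3 ≤ n →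
    Σ (List (Vec (Fin n) n)) λ L →
      Unique L ×
      (∀ π → (π ∈ L) ⇔ (IsPerm π × Avoids123 π × ides π ≡ 1)) ×
      (∀ k → (n ≡ 2 * k + 1 → length L ≡ 4) × (n ≡ 2 * k → length L ≡ 5))
proposition4p4 (suc (suc (suc j))) (s≤s (s≤s (s≤s z≤n))) with odd j in parity
... | false = let L , unique , members , length≡4 = OddSize.enumerated j parity in
  L , unique , members , λ k →
    (λ _ → length≡4) , (λ n≡2k → contradiction n≡2k (odd⇒≢double k (OddSize.n-odd j parity)))
... | true = let L , unique , members , length≡5 = EvenSize.enumerated j parity in
  L , unique , members , λ k →
    (λ n≡2k+1 → contradiction n≡2k+1 (even⇒≢double+1 k (EvenSize.n-even j parity))) , (λ _ → length≡5)
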